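{- (i) For every integer $d\ge1$ and every integer $n\ge4$, $\lambda_d(n)\le n-2$. (ii) For every integer $d\ge 1$, $\lambda_d(d)\le 4$.
   Context: For $f:\mathbb{N}\to\mathbb{N}$, $f^{(i)}$ denotes $i$-fold composition ($f^{(0)}$ the identity) and $f^*(n)=\min\{i: f^{(i)}(n)\le1\}$. Define $\lambda_1(n)=\lfloor\sqrt n\rfloor$, $\lambda_2(n)=\lceil\log_2 n\rceil$, and $\lambda_d(n)=\lambda_{d-2}^*(n)$ for $d\ge3$. -}

module Defs where

open import Data.Nat using (ℕ; zero; suc; _*_; _≤_; _≤ᵇ_)
open import Data.Nat.Logarithm using (⌈log₂_⌉)
open import Data.Bool using (if_then_else_)

iter : (ℕ → ℕ) → ℕ → ℕ → ℕ
iter f zero    n = n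
iter f (suc i) n = f (iter f i n)

isqrtFrom : ℕ → ℕ → ℕ
isqrtFrom zero    n = zero
isqrtFrom (suc k) n = if (suc k * suc k) ≤ᵇ n then suc k else isqrtFrom k n

⌊√_⌋ : ℕ → ℕ
⌊√ n ⌋ = isqrtFrom n n

-- f*(n) = min { i : f^(i)(n) ≤ 1 }, searched over i = 0 … n
-- (for all λ_d used here f(m) < m for m ≥ 2, so the minimum is ≤ n and the
-- search is exact; the default value n on failure is never used)
starFrom : (ℕ → ℕ) → ℕ → ℕ → ℕ → ℕ
starFrom f n i zero       = if iter f i n ≤ᵇ 1 then i else n
starFrom f n i (suc fuel) = if iter f i n ≤ᵇ 1 then i else starFrom f n (suc i) fuel

star : (ℕ → ℕ) → ℕ → ℕ
star f n = starFrom f n 0 n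

-- λ_d for d ≥ 1 (λ 0 is an unused dummy, set to the identity)
λ′ : ℕ → ℕ → ℕ
λ′ zero          n = n
λ′ (suc zero)    n = ⌊√ n ⌋
λ′ (suc (suc zero)) n = ⌈log₂ n ⌉
λ′ (suc (suc (suc d))) n = star (λ′ (suc d)) n

{-# OPTIONS --safe #-}
module Submission where

-- Call f shrinking if f m ≤ 1 for m ≤ 2 and f m < m otherwise; iterating such an
-- f brings m down to 1 within m ∸ 1 steps, so f* is shrinking again. If moreover
-- f n ≤ n ∸ 2 for n ≥ 4, then the first step already saves one, whence
-- f*(n) ≤ n ∸ 2. Both properties hold for ⌊√_⌋ and ⌈log₂_⌉, hence for every λ_d.
-- For (ii), if f ≤ 4 on [0, b] then f* ≤ 4 on [0, b + 2]: for 4 ≤ n ≤ b + 2 we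
-- get f n ≤ b, so f (f n) ≤ 4, f³ n ≤ 2 and f⁴ n ≤ 1. Starting from b = 3 and
-- b = 4 for d = 1, 2 this gives λ_d ≤ 4 on [0, d + 2].

open import Defs
open import Data.Nat using (ℕ; zero; suc; _+_; _*_; _^_; _∸_; _≤_; _≤ᵇ_; z≤n; s≤s)
open import Data.Nat.Properties
open import Data.Nat.Logarithm using (⌈log₂_⌉; ⌈log₂⌉-mono-≤; ⌈log₂2^n⌉≡n)
open import Data.Bool using (true; false)
open import Data.Product using (_×_; _,_)
open import Data.Sum using (_⊎_; inj₁; inj₂)
open import Relation.Binary.PropositionalEquality using (_≡_; refl; sym; cong; subst)

private
  variable
    f : ℕ → ℕ
    b i k m n fuel : ℕ

iter-suc : ∀ f k m → iter f (suc k) m ≡ iter f k (f m)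
iter-suc f zero    m = refl
iter-suc f (suc k) m = cong f (iter-suc f k m)

starFrom-hit : iter f i n ≤ 1 → starFrom f n i fuel ≡ i
starFrom-hit {f = f} {i = i} {n = n} {fuel = zero} hit with iter f i n ≤ᵇ 1 | ≤⇒≤ᵇ hit
... | true  | _ = refl
starFrom-hit {f = f} {i = i} {n = n} {fuel = suc _} hit with iter f i n ≤ᵇ 1 | ≤⇒≤ᵇ hit
... | true  | _ = refl

starFrom-≤ : ∀ i → k ≤ fuel → iter f (i + k) n ≤ 1 → starFrom f n i fuel ≤ i + k
starFrom-≤ {k = zero} {fuel = fuel} i _ hit rewrite +-identityʳ i =
  ≤-reflexive (starFrom-hit {fuel = fuel} hit)
starFrom-≤ {k = suc k} {fuel = suc fuel} {f = f} {n = n} i (s≤s k≤fuel) hit with iter f i n ≤ᵇ 1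
... | true  = m≤m+n i (suc k)
... | false rewrite +-suc i k = starFrom-≤ (suc i) k≤fuel hit

star-≤ : k ≤ n → iter f k n ≤ 1 → star f n ≤ k
star-≤ = starFrom-≤ 0

Shrinking : (ℕ → ℕ) → Set
Shrinking f = ∀ m → f m ≤ suc (m ∸ 2)

ShrinkingBy2 : (ℕ → ℕ) → Set
ShrinkingBy2 f = ∀ n → 4 ≤ n → f n ≤ n ∸ 2

shrinking-≤ : Shrinking f → m ≤ n → f m ≤ suc (n ∸ 2)
shrinking-≤ {m = m} shrinks m≤n = ≤-trans (shrinks m) (s≤s (∸-monoˡ-≤ 2 m≤n))

iter-shrinking-≤1 : Shrinking f → ∀ k → m ≤ suc k → iter f k m ≤ 1
iter-shrinking-≤1 shrinks zero m≤1 = m≤1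
iter-shrinking-≤1 {f = f} {m = m} shrinks (suc k) m≤2+k rewrite iter-suc f k m =
  iter-shrinking-≤1 shrinks k (shrinking-≤ shrinks m≤2+k)

star-shrinking-≤ : Shrinking f → f n ≤ suc k → suc k ≤ n → star f n ≤ suc k
star-shrinking-≤ {f = f} {n = n} {k = k} shrinks fn≤1+k 1+k≤n =
  star-≤ 1+k≤n (subst (_≤ 1) (sym (iter-suc f k n)) (iter-shrinking-≤1 shrinks k fn≤1+k))

star-shrinking : Shrinking f → Shrinking (star f)
star-shrinking shrinks zero          = z≤n
star-shrinking shrinks (suc zero)    = z≤n
star-shrinking shrinks (suc (suc m)) =
  star-shrinking-≤ shrinks (shrinking-≤ shrinks ≤-refl) (n≤1+n (suc m))

star-shrinking₂ : Shrinking f → ShrinkingBy2 f → ShrinkingBy2 (star f)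
star-shrinking₂ shrinks shrinks₂ n@(suc (suc (suc (suc m)))) 4≤n@(s≤s (s≤s (s≤s (s≤s _)))) =
  star-shrinking-≤ shrinks (shrinks₂ n 4≤n) (m≤n+m (suc (suc m)) 2)

≤4⇒f[f]≤1 : Shrinking f → ShrinkingBy2 f → m ≤ 4 → f (f m) ≤ 1
≤4⇒f[f]≤1 {f = f} {m = m} shrinks shrinks₂ m≤4 = shrinking-≤ shrinks fm≤2
  where
  fm≤2 : f m ≤ 2
  fm≤2 with m≤n⇒m<n∨m≡n m≤4
  ... | inj₁ m<4 = shrinking-≤ shrinks (≤-pred m<4)
  ... | inj₂ refl = shrinks₂ 4 ≤-refl

record Tame (b : ℕ) (f : ℕ → ℕ) : Set where
  field
    shrinking  : Shrinking f
    shrinking₂ : ShrinkingBy2 f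
    ≤4-upTo    : n ≤ b → f n ≤ 4

star-tame : Tame b f → Tame (2 + b) (star f)
star-tame {b = b} {f = f} tame = record
  { shrinking  = star-shrinking shrinking
  ; shrinking₂ = star-shrinking₂ shrinking shrinking₂
  ; ≤4-upTo    = star-≤4
  }
  where
  open Tame tame

  star-≤4 : n ≤ 2 + b → star f n ≤ 4
  star-≤4 {n} n≤2+b with ≤-total 4 n
  ... | inj₁ 4≤n = star-≤ 4≤n (≤4⇒f[f]≤1 shrinking shrinking₂ (≤4-upTo fn≤b))
    where
    fn≤b : f n ≤ b
    fn≤b = ≤-trans (shrinking₂ n 4≤n) (∸-monoˡ-≤ 2 n≤2+b)
  ... | inj₂ n≤4 = ≤-trans (shrinking-≤ (star-shrinking shrinking) n≤4) (n≤1+n 3)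

shrinking⇒tame : Shrinking f → ShrinkingBy2 f → b ≤ 5 → Tame b f
shrinking⇒tame shrinks shrinks₂ b≤5 = record
  { shrinking  = shrinks
  ; shrinking₂ = shrinks₂
  ; ≤4-upTo    = λ n≤b → shrinking-≤ shrinks (≤-trans n≤b b≤5)
  }

isqrtFrom-square-≤ : ∀ k n → isqrtFrom k n * isqrtFrom k n ≤ n
isqrtFrom-square-≤ zero    n = z≤n
isqrtFrom-square-≤ (suc k) n with suc k * suc k ≤ᵇ n | ≤ᵇ⇒≤ (suc k * suc k) n
... | true  | sound = sound _
... | false | _     = isqrtFrom-square-≤ k n

square-≤⇒≤1⊎+2≤ : ∀ r → r * r ≤ n → r ≤ 1 ⊎ r + 2 ≤ n
square-≤⇒≤1⊎+2≤ zero          _    = inj₁ z≤n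
square-≤⇒≤1⊎+2≤ (suc zero)    _    = inj₁ ≤-refl
square-≤⇒≤1⊎+2≤ r@(suc (suc s)) r²≤n = inj₂ (≤-trans (+-monoʳ-≤ r 2≤[1+s]*r) r²≤n)
  where
  2≤[1+s]*r : 2 ≤ suc s * r
  2≤[1+s]*r = ≤-trans (s≤s (s≤s z≤n)) (m≤m+n r (s * r))

⌊√⌋-≤1⊎+2≤ : ∀ n → ⌊√ n ⌋ ≤ 1 ⊎ ⌊√ n ⌋ + 2 ≤ n
⌊√⌋-≤1⊎+2≤ n = square-≤⇒≤1⊎+2≤ ⌊√ n ⌋ (isqrtFrom-square-≤ n n)

⌊√⌋-shrinking : Shrinking ⌊√_⌋
⌊√⌋-shrinking n with ⌊√⌋-≤1⊎+2≤ n
... | inj₁ r≤1   = ≤-trans r≤1 (s≤s z≤n)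
... | inj₂ r+2≤n = m≤n⇒m≤1+n (m+n≤o⇒m≤o∸n _ r+2≤n)

⌊√⌋-shrinking₂ : ShrinkingBy2 ⌊√_⌋
⌊√⌋-shrinking₂ n 4≤n with ⌊√⌋-≤1⊎+2≤ n
... | inj₁ r≤1   = ≤-trans r≤1 (∸-monoˡ-≤ 2 (≤-trans (n≤1+n 3) 4≤n))
... | inj₂ r+2≤n = m+n≤o⇒m≤o∸n _ r+2≤n

4+m≤2^[2+m] : ∀ m → 4 + m ≤ 2 ^ (2 + m)
4+m≤2^[2+m] zero    = ≤-refl
4+m≤2^[2+m] (suc m) = ≤-trans (+-mono-≤ (m^n>0 2 (2 + m)) (4+m≤2^[2+m] m))
                              (≤-reflexive (cong (2 ^ (2 + m) +_) (sym (+-identityʳ _))))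

⌈log₂⌉-shrinking₂ : ShrinkingBy2 ⌈log₂_⌉
⌈log₂⌉-shrinking₂ (suc (suc (suc (suc m)))) (s≤s (s≤s (s≤s (s≤s _)))) =
  ≤-trans (⌈log₂⌉-mono-≤ (4+m≤2^[2+m] m)) (≤-reflexive (⌈log₂2^n⌉≡n (2 + m)))

⌈log₂⌉-shrinking : Shrinking ⌈log₂_⌉
⌈log₂⌉-shrinking 0 = z≤n
⌈log₂⌉-shrinking 1 = z≤n
⌈log₂⌉-shrinking 2 = ≤-refl
⌈log₂⌉-shrinking 3 = ≤-refl
⌈log₂⌉-shrinking n@(suc (suc (suc (suc _)))) =
  m≤n⇒m≤1+n (⌈log₂⌉-shrinking₂ n (s≤s (s≤s (s≤s (s≤s z≤n)))))

λ-tame : ∀ d → Tame (3 + d) (λ′ (suc d))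
λ-tame zero          = shrinking⇒tame ⌊√⌋-shrinking ⌊√⌋-shrinking₂ (m≤n+m 3 2)
λ-tame (suc zero)    = shrinking⇒tame ⌈log₂⌉-shrinking ⌈log₂⌉-shrinking₂ (n≤1+n 4)
λ-tame (suc (suc d)) = star-tame (λ-tame d)

propositionA2 : ((d n : ℕ) → 1 ≤ d → 4 ≤ n → λ′ d n ≤ n ∸ 2)
                × ((d : ℕ) → 1 ≤ d → λ′ d d ≤ 4)
propositionA2 = λ-shrinking₂ , λ-diagonal-≤4
  where
  λ-shrinking₂ : (d n : ℕ) → 1 ≤ d → 4 ≤ n → λ′ d n ≤ n ∸ 2
  λ-shrinking₂ (suc d) n _ = Tame.shrinking₂ (λ-tame d) n

  λ-diagonal-≤4 : (d : ℕ) → 1 ≤ d → λ′ d d ≤ 4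
  λ-diagonal-≤4 (suc d) _ = Tame.≤4-upTo (λ-tame d) (m≤n+m (suc d) 2)
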